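{- Let $G$ be an oriented map on an oriented surface and $a_0$ a root angle. Then the execution of Algorithm PS on $(G,a_0)$ terminates, and the sequence of angles it considers forms a (simple) cycle in the angle graph of $G$, passing through $a_0$.
   Context: A map is a graph embedded on a surface with all faces open disks; here edges are oriented arbitrarily. The angle graph of $G$ has the angles of $G$ as vertices, two angles being adjacent if they are consecutive around a vertex or around a face. An angle at vertex $v$ is identified with the pair $(v,e)$ where $e$ is the edge just after the angle in counterclockwise order around $v$. Algorithm PS. Input: $G$ and $a_0=(v_0,e_0)$. Set $v:=v_0$, $e:=e_0$, $U:=\emptyset$ and repeat: let $v'$ be the other end of $e$; if $e$ is unmarked and enters $v$, add $e$ to $U$ and set $v:=v'$; if $e$ is unmarked and leaves $v$, add to $U$ a stem at $v$ corresponding to $e$; if $e$ is marked and enters $v$, do nothing; if $e$ is marked and leaves $v$, set $v:=v'$. Then mark $e$, let $e$ be the next edge around $v$ in counterclockwise order after $e$, and stop when $(v,e)=(v_0,e_0)$. The angle considered at each iteration is $(v,e)$. -}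

module Defs where

open import Data.Nat using (ℕ; zero; suc; _<_; _≤_)
open import Data.Fin using (Fin; _≟_)
open import Data.Fin.Permutation using (Permutation′; _⟨$⟩ʳ_)
open import Data.Bool using (Bool; true; false; not; _∨_; if_then_else_)
open import Data.Product using (_×_; _,_; proj₁; proj₂)
open import Data.Sum using (_⊎_)
open import Relation.Binary.PropositionalEquality using (_≡_; _≢_)
open import Relation.Nullary using (does)

-- Combinatorial oriented map with n darts (half-edges).
--  σ : next dart counterclockwise around its vertex (rotation system; encodes
--      the embedding in an oriented surface, all faces being discs),
--  α : fixed-point-free involution sending a dart to the other half of its edge,
--  out d = true  iff the edge of d is oriented leaving the vertex of d.
record OrientedMap (n : ℕ) : Set where
  field
    σ       : Permutation′ n
    α       : Fin n → Fin n
    α-invol : ∀ d → α (α d) ≡ d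
    α-fpf   : ∀ d → α d ≢ d
    out     : Fin n → Bool
    out-α   : ∀ d → out (α d) ≡ not (out d)

  σ· : Fin n → Fin n
  σ· d = σ ⟨$⟩ʳ d

  data Reach (d : Fin n) : Fin n → Set where
    here  : Reach d d
    viaσ  : ∀ {e} → Reach d e → Reach d (σ· e)
    viaα  : ∀ {e} → Reach d e → Reach d (α e)

  -- An angle at vertex v is identified with (v,e), e the edge just after the
  -- angle counterclockwise around v; i.e. with the dart of e at v.
  -- Angle graph adjacency: consecutive around a vertex (d, σ d), or
  -- consecutive around a face (d, σ (α d)); symmetric closure.
  AngleStep : Fin n → Fin n → Set
  AngleStep d d' = (d' ≡ σ· d) ⊎ (d' ≡ σ· (α d))

  AngleAdj : Fin n → Fin n → Set
  AngleAdj d d' = AngleStep d d' ⊎ AngleStep d' d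

  -- State of Algorithm PS: current angle (dart d, i.e. the pair (v,e)) and
  -- the set of marked edges, stored as a marking of darts (both darts of an
  -- edge are marked together).
  State : Set
  State = Fin n × (Fin n → Bool)

  mark : Fin n → (Fin n → Bool) → (Fin n → Bool)
  mark d m x = m x ∨ does (x ≟ d) ∨ does (x ≟ α d)

  -- One iteration of Algorithm PS (the stored set U does not influence the
  -- angles visited, so it is omitted).
  --  unmarked & enters : v := v'  , then e := next after e around v'  (σ (α d))
  --  unmarked & leaves : stay     , e := next around v                 (σ d)
  --  marked   & enters : stay     , (σ d)
  --  marked   & leaves : v := v'  , (σ (α d))
  step : State → State
  step (d , m) =
    (if m d
       then (if out d then σ· (α d) else σ· d)
       else (if out d then σ· d else σ· (α d)))
    , mark d m

  run : Fin n → ℕ → State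
  run d₀ zero    = d₀ , (λ _ → false)
  run d₀ (suc k) = step (run d₀ k)

  angle : Fin n → ℕ → Fin n
  angle d₀ i = proj₁ (run d₀ i)

-- Algorithm PS leaves the current angle d by turning around the vertex of one
-- dart x of the edge of d, and the orientation of x is forced by whether that
-- edge is already marked.  So if two considered angles i < m had the same
-- successor, they would leave through the same dart with the same marking
-- status; the edge is marked at time m (it was visited at time i), hence it was
-- already marked at time i, so it was visited at three different times before
-- the first repetition.  An edge has only two darts, so this is impossible:
-- the first repeated angle is a₀, and by pigeonhole it appears within n + 1
-- steps.
module Submission where

open import Defs
open import Data.Nat using (ℕ; zero; suc; _<_; _≤_; z≤n; s≤s; _+_)
open import Data.Nat.Properties
  using (<⇒≢; m<n⇒m<1+n; ≤-refl; <-trans; m≤n⇒m≤1+n; m≤n⇒m<n∨m≡n; +-suc; +-comm; anyUpTo?)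
open import Data.Fin using (Fin; toℕ; _≟_)
open import Data.Fin.Properties using (pigeonhole; toℕ<n)
open import Data.Bool using (Bool; true; false; T; not)
open import Data.Bool.Properties using (not-injective; T-∨)
open import Data.Product using (Σ; ∃; _×_; _,_; proj₂)
open import Data.Sum using (_⊎_; inj₁; inj₂; map)
open import Data.Empty using (⊥; ⊥-elim)
open import Function.Bundles using (Injection; _⇔_; mk⇔)
open Function.Bundles.Equivalence using (to; from)
open import Function.Properties.Inverse using (↔⇒↣)
open import Relation.Nullary using (yes; no; ¬_; does)
open import Relation.Binary.PropositionalEquality
open OrientedMap using (Reach; angle; AngleAdj)

InjectiveBelow : ∀ {a} {A : Set a} → (ℕ → A) → ℕ → Set a
InjectiveBelow f k = ∀ i j → i < k → j < k → f i ≡ f j → i ≡ j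

injectiveBelow-extend : ∀ {a} {A : Set a} {f : ℕ → A} {k} →
  InjectiveBelow f k → (∀ j → j < k → f k ≢ f j) → InjectiveBelow f (suc k)
injectiveBelow-extend {k = k} inj new i j (s≤s i≤k) (s≤s j≤k) fi≡fj
  with m≤n⇒m<n∨m≡n i≤k | m≤n⇒m<n∨m≡n j≤k
... | inj₁ i<k  | inj₁ j<k  = inj i j i<k j<k fi≡fj
... | inj₁ i<k  | inj₂ refl = ⊥-elim (new i i<k (sym fi≡fj))
... | inj₂ refl | inj₁ j<k  = ⊥-elim (new j j<k fi≡fj)
... | inj₂ refl | inj₂ refl = refl

injectiveBelow-≢ : ∀ {a} {A : Set a} {f : ℕ → A} {k i j} →
  InjectiveBelow f k → i < j → j < k → f i ≢ f j
injectiveBelow-≢ inj i<j j<k fi≡fj = <⇒≢ i<j (inj _ _ (<-trans i<j j<k) j<k fi≡fj)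

¬injectiveBelow-suc : ∀ {n} (f : ℕ → Fin n) → ¬ InjectiveBelow f (suc n)
¬injectiveBelow-suc {n} f inj with pigeonhole ≤-refl (λ (i : Fin (suc n)) → f (toℕ i))
... | i , j , i<j , fi≡fj = injectiveBelow-≢ inj i<j (toℕ<n j) fi≡fj

firstRepetition : ∀ {n} (f : ℕ → Fin n) →
  ∃ λ k → ∃ λ j → j < k × f k ≡ f j × InjectiveBelow f k
firstRepetition {n} f = search n 1 (+-comm n 1) injectiveBelow-one
  where
  injectiveBelow-one : InjectiveBelow f 1
  injectiveBelow-one zero zero _ _ _ = refl
  injectiveBelow-one (suc _) _ (s≤s ()) _ _
  injectiveBelow-one _ (suc _) _ (s≤s ()) _

  search : ∀ fuel k → fuel + k ≡ suc n → InjectiveBelow f k →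
           ∃ λ k → ∃ λ j → j < k × f k ≡ f j × InjectiveBelow f k
  search zero k refl inj = ⊥-elim (¬injectiveBelow-suc f inj)
  search (suc fuel) k eq inj with anyUpTo? (λ j → f k ≟ f j) k
  ... | yes (j , j<k , fk≡fj) = k , j , j<k , fk≡fj , inj
  ... | no  none              =
    search fuel (suc k) (trans (+-suc fuel k) eq)
      (injectiveBelow-extend inj (λ j j<k fk≡fj → none (j , j<k , fk≡fj)))

T-≟ : ∀ {n} {x y : Fin n} → T (does (x ≟ y)) ⇔ x ≡ y
T-≟ {x = x} {y} with x ≟ y
... | yes x≡y = mk⇔ (λ _ → x≡y) (λ _ → _)
... | no  x≢y = mk⇔ (λ ()) x≢y

module _ {n} (G : OrientedMap n) where
  open OrientedMap G hiding (Reach; angle; AngleAdj)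

  σ-injective : ∀ {x y} → σ· x ≡ σ· y → x ≡ y
  σ-injective = Injection.injective (↔⇒↣ σ)

  SameEdge : Fin n → Fin n → Set
  SameEdge x y = (y ≡ x) ⊎ (y ≡ α x)

  SameEdge-sym : ∀ {x y} → SameEdge x y → SameEdge y x
  SameEdge-sym (inj₁ refl) = inj₁ refl
  SameEdge-sym {x} (inj₂ refl) = inj₂ (sym (α-invol x))

  SameEdge-trans : ∀ {x y z} → SameEdge x y → SameEdge y z → SameEdge x z
  SameEdge-trans (inj₁ refl) y~z = y~z
  SameEdge-trans (inj₂ refl) (inj₁ refl) = inj₂ refl
  SameEdge-trans {x} (inj₂ refl) (inj₂ refl) = inj₁ (α-invol x)

  edge-has-two-darts : ∀ {x a b c} → SameEdge x a → SameEdge x b → SameEdge x c →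
                       a ≡ b ⊎ a ≡ c ⊎ b ≡ c
  edge-has-two-darts (inj₁ refl) (inj₁ refl) _           = inj₁ refl
  edge-has-two-darts (inj₂ refl) (inj₂ refl) _           = inj₁ refl
  edge-has-two-darts (inj₁ refl) (inj₂ refl) (inj₁ refl) = inj₂ (inj₁ refl)
  edge-has-two-darts (inj₁ refl) (inj₂ refl) (inj₂ refl) = inj₂ (inj₂ refl)
  edge-has-two-darts (inj₂ refl) (inj₁ refl) (inj₁ refl) = inj₂ (inj₂ refl)
  edge-has-two-darts (inj₂ refl) (inj₁ refl) (inj₂ refl) = inj₂ (inj₁ refl)

  T-mark : ∀ d m y → T (mark d m y) → T (m y) ⊎ SameEdge d y
  T-mark d m y marked with to (T-∨ {m y}) marked
  ... | inj₁ earlier = inj₁ earlier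
  ... | inj₂ new     = inj₂ (map (to T-≟) (to T-≟) (to (T-∨ {does (y ≟ d)}) new))

  mark-T : ∀ d m y → T (m y) ⊎ SameEdge d y → T (mark d m y)
  mark-T d m y (inj₁ earlier) = from (T-∨ {m y}) (inj₁ earlier)
  mark-T d m y (inj₂ d~y)     =
    from (T-∨ {m y}) (inj₂ (from (T-∨ {does (y ≟ d)}) (map (from T-≟) (from T-≟) d~y)))

  module Run (a₀ : Fin n) where

    ang : ℕ → Fin n
    ang = OrientedMap.angle G a₀

    marks : ℕ → Fin n → Bool
    marks t = proj₂ (run a₀ t)

    marked⇒visited : ∀ t {y} → T (marks t y) → ∃ λ s → s < t × SameEdge (ang s) y
    marked⇒visited zero ()
    marked⇒visited (suc t) {y} marked with T-mark (ang t) (marks t) y marked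
    ... | inj₁ earlier = let s , s<t , s~y = marked⇒visited t earlier
                         in s , m≤n⇒m≤1+n s<t , s~y
    ... | inj₂ t~y     = t , ≤-refl , t~y

    visited⇒marked : ∀ {t s y} → s < t → SameEdge (ang s) y → T (marks t y)
    visited⇒marked {suc t} {y = y} (s≤s s≤t) s~y with m≤n⇒m<n∨m≡n s≤t
    ... | inj₁ s<t  = mark-T (ang t) (marks t) y (inj₁ (visited⇒marked s<t s~y))
    ... | inj₂ refl = mark-T (ang t) (marks t) y (inj₂ s~y)

    exit : ∀ t → ∃ λ x → ang (suc t) ≡ σ· x × SameEdge (ang t) x × out x ≡ not (marks t (ang t))
    exit t with marks t (ang t) | out (ang t) in outgoing
    ... | true  | true  = α (ang t) , refl , inj₂ refl , trans (out-α (ang t)) (cong not outgoing)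
    ... | true  | false = ang t , refl , inj₁ refl , outgoing
    ... | false | true  = ang t , refl , inj₁ refl , outgoing
    ... | false | false = α (ang t) , refl , inj₂ refl , trans (out-α (ang t)) (cong not outgoing)

    consecutive-adjacent : ∀ t → AngleAdj G (ang t) (ang (suc t))
    consecutive-adjacent t with exit t
    ... | x , next , inj₁ refl , _ = inj₁ (inj₁ next)
    ... | x , next , inj₂ refl , _ = inj₁ (inj₂ next)

    ¬three-visits : ∀ {s i m} → InjectiveBelow ang (suc m) → s < i → i < m →
                    SameEdge (ang s) (ang i) → SameEdge (ang i) (ang m) → ⊥
    ¬three-visits inj s<i i<m s~i i~m
      with edge-has-two-darts (inj₁ refl) s~i (SameEdge-trans s~i i~m)
    ... | inj₁ s≡i        = injectiveBelow-≢ inj s<i (m<n⇒m<1+n i<m) s≡i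
    ... | inj₂ (inj₁ s≡m) = injectiveBelow-≢ inj (<-trans s<i i<m) ≤-refl s≡m
    ... | inj₂ (inj₂ i≡m) = injectiveBelow-≢ inj i<m ≤-refl i≡m

    successor-injective : ∀ {i m} → InjectiveBelow ang (suc m) → i < m → ang (suc i) ≢ ang (suc m)
    successor-injective {i} {m} inj i<m next≡ with exit i | exit m
    ... | x , next-i , i~x , out-i | y , next-m , m~y , out-m =
      let s , s<i , s~i = earlier-visit in ¬three-visits inj s<i i<m s~i i~m
      where
      x≡y : x ≡ y
      x≡y = σ-injective (trans (sym next-i) (trans next≡ next-m))
      i~m : SameEdge (ang i) (ang m)
      i~m = SameEdge-trans i~x (subst (λ z → SameEdge z (ang m)) (sym x≡y) (SameEdge-sym m~y))
      same-status : marks i (ang i) ≡ marks m (ang m)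
      same-status = not-injective (trans (sym out-i) (trans (cong out x≡y) out-m))
      earlier-visit : ∃ λ s → s < i × SameEdge (ang s) (ang i)
      earlier-visit = marked⇒visited i (subst T (sym same-status) (visited⇒marked i<m i~m))

    firstReturn : ∃ λ m → ang (suc m) ≡ a₀ × InjectiveBelow ang (suc m)
    firstReturn with firstRepetition ang
    ... | suc m , zero  , _        , returns , inj = m , returns , inj
    ... | suc m , suc i , s≤s i<m , repeats , inj =
      ⊥-elim (successor-injective inj i<m (sym repeats))

proposition1 : ∀ {n} (G : OrientedMap n) →
    (∀ d d' → Reach G d d') →
    (a₀ : Fin n) →
    Σ ℕ λ k →
    (1 ≤ k) ×
    (angle G a₀ k ≡ a₀) ×
    (∀ i j → i < k → j < k → angle G a₀ i ≡ angle G a₀ j → i ≡ j) ×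
    (∀ i → i < k → AngleAdj G (angle G a₀ i) (angle G a₀ (suc i)))
proposition1 G _ a₀ =
  let m , returns , inj = firstReturn in
  suc m , s≤s z≤n , returns , inj , λ i _ → consecutive-adjacent i
  where open Run G a₀
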